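{- Define partial maps $\rho_1$ and $\psi_2$ on the set of partitions as follows. Let $\lambda$ be a partition with $j=\lambda_1$ boxes in its first (bottom) row and $k=\lambda'_1$ boxes in its first (leftmost) column (for $\lambda=\emptyset$, $j=k=0$). - $\rho_1(\lambda)$ is defined if and only if $j\ge k-2$, and it is the partition whose column heights (from left to right) are $j+1,\ \lambda'_1-1,\ \lambda'_2-1,\ \dots,\ \lambda'_{j}-1$ (discarding zeros); i.e. remove the first row of $\lambda$, add one box to it, and insert it as a new first column. - $\psi_2(\lambda)$ is defined if and only if $j\le k+3$, and it is the partition whose row lengths (from bottom to top) are $k+2,\ \lambda_1-1,\ \lambda_2-1,\ \dots,\ \lambda_k-1$ (discarding zeros); i.e. remove the first column of $\lambda$, add two boxes to it, and insert it as a new first row. Then every partition $\lambda$ can be written uniquely as the result of applying a finite sequence of the maps $\rho_1$ and $\psi_2$ to the empty partition $\emptyset$, i.e. there is a unique finite sequence $(s_1,\dots,s_m)$ with each $s_i\in\{\rho_1,\psi_2\}$ such that each successive application is defined and $\lambda=s_m(s_{m-1}(\cdots s_1(\emptyset)\cdots))$.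
   Context: Partitions are drawn as southwest-justified Young diagrams: $\lambda=(\lambda_1\ge\lambda_2\ge\cdots)$ has $\lambda_r$ boxes in the $r$-th row from the bottom, and $\lambda'=(\lambda'_1\ge\lambda'_2\ge\cdots)$ is the conjugate partition, $\lambda'_c$ being the height of the $c$-th column from the left. -}

module Defs where

open import Data.Nat using (ℕ; zero; suc; _+_; _≤_; _<_; _≤?_; _<?_; pred)
open import Data.List using (List; []; _∷_; map; filter; length; upTo; foldl)
open import Data.List.Relation.Unary.All using (All)
open import Data.List.Relation.Unary.Linked using (Linked)
open import Data.Maybe using (Maybe; just; nothing; _>>=_)
open import Relation.Nullary.Decidable using (does)
open import Data.Bool using (if_then_else_)

-- A partition is represented by its list of row lengths λ₁ ≥ λ₂ ≥ ⋯ > 0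
-- (bottom row first); the empty partition is [].
IsPartition : List ℕ → Set
IsPartition l = Linked (λ a b → b ≤ a) l × All (λ x → 0 < x) l
  where open import Data.Product using (_×_)

first : List ℕ → ℕ
first []      = 0
first (x ∷ _) = x

conj : List ℕ → List ℕ
conj l = map (λ c → length (filter (λ x → suc c ≤? x) l)) (upTo (first l))

dropZeros : List ℕ → List ℕ
dropZeros = filter (λ x → 0 <? x)

-- New column heights: j+1, λ'₁-1, …, λ'_j-1 (zeros discarded); the
-- result is returned by its row lengths (the conjugate of the columns).
ρ₁ : List ℕ → Maybe (List ℕ)
ρ₁ l = if does (length l ≤? first l + 2)
       then just (conj (suc (first l) ∷ dropZeros (map pred (conj l))))
       else nothing

ψ₂ : List ℕ → Maybe (List ℕ)
ψ₂ l = if does (first l ≤? length l + 3)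
       then just (suc (suc (length l)) ∷ dropZeros (map pred l))
       else nothing

data Step : Set where
  rho1 psi2 : Step

applyStep : Step → List ℕ → Maybe (List ℕ)
applyStep rho1 = ρ₁
applyStep psi2 = ψ₂

run : List Step → Maybe (List ℕ)
run = foldl (λ m s → m >>= applyStep s) (just [])

-- Both maps are one operation up to conjugation. Let columnToRow d ν turn the first column of ν
-- into a new first row lengthened by d boxes; then ψ₂ = columnToRow 2 and ρ₁ = conj ∘ columnToRow 1 ∘ conj.
-- On partitions columnToRow d is injective (addColumn undoes it), and its image consists exactly of
-- the nonempty partitions whose first row has at least d boxes more than the number of remaining rows.
-- Hence a nonempty partition is the result of exactly one step, ρ₁ if λ₁ ≤ λ'₁ and ψ₂ otherwise,
-- applied to exactly one partition, which has fewer boxes; induction on the number of boxes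
-- yields a unique sequence of steps from ∅.

module Submission where

open import Defs
open import Data.Bool using (if_then_else_)
open import Data.Empty using (⊥-elim)
open import Data.List using (List; []; _∷_; map; filter; length; applyUpTo; reverse; _∷ʳ_)
open import Data.List.Properties
  using (∷-injective; length-filter; filter-accept; filter-reject; map-upTo; map-applyUpTo; length-applyUpTo;
         length-map; foldl-∷ʳ; unfold-reverse; reverse-involutive)
open import Data.List.Relation.Unary.All as All using (All; []; _∷_)
import Data.List.Relation.Unary.All.Properties as All
open import Data.List.Relation.Unary.Linked as Linked using (Linked; []; [-]; _∷_)
import Data.List.Relation.Unary.Linked.Properties as Linked
open import Data.Maybe using (Maybe; just; nothing; _>>=_)
open import Data.Nat using (ℕ; zero; suc; _+_; _∸_; _≤_; _<_; _≤?_; _<?_; pred; z≤n; s≤s; s≤s⁻¹)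
open import Data.Nat.ListAction using (sum)
open import Data.Nat.Properties
open import Algebra.Properties.CommutativeSemigroup +-commutativeSemigroup using (x∙yz≈y∙xz)
open import Data.Product using (∃; ∃!; _×_; _,_; proj₁; proj₂)
open import Function using (_∘_; id)
open import Relation.Nullary using (Dec; yes; no; ¬_)
open import Relation.Nullary.Decidable using (does)
open import Relation.Binary.PropositionalEquality

Decreasing : List ℕ → Set
Decreasing = Linked (λ a b → b ≤ a)

Positive : List ℕ → Set
Positive = All (0 <_)

partition-tail : ∀ {x xs} → IsPartition (x ∷ xs) → IsPartition xs
partition-tail (dec , _ ∷ pos) = Linked.tail dec , pos

first-≤ : ∀ {x xs} → Decreasing (x ∷ xs) → first xs ≤ x
first-≤ [-]       = z≤n
first-≤ (x≥y ∷ _) = x≥y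

all-≤-first : ∀ {l} → Decreasing l → All (_≤ first l) l
all-≤-first {[]}    _   = []
all-≤-first {_ ∷ _} dec = Linked.Linked⇒All (λ p q → ≤-trans q p) ≤-refl dec

∷-partition : ∀ {x xs} → first xs ≤ x → 0 < x → IsPartition xs → IsPartition (x ∷ xs)
∷-partition {xs = []}    _   0<x _            = [-] , 0<x ∷ []
∷-partition {xs = _ ∷ _} y≤x 0<x (dec , pos) = y≤x ∷ dec , 0<x ∷ pos

applyUpTo-cong : ∀ {A : Set} (f g : ℕ → A) n → (∀ {i} → i < n → f i ≡ g i) → applyUpTo f n ≡ applyUpTo g n
applyUpTo-cong f g zero    f≗g = refl
applyUpTo-cong f g (suc n) f≗g = cong₂ _∷_ (f≗g (s≤s z≤n)) (applyUpTo-cong (f ∘ suc) (g ∘ suc) n (f≗g ∘ s≤s))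

dropZeros-applyUpTo : ∀ (f : ℕ → ℕ) {m n} → m ≤ n → (∀ {i} → i < m → 0 < f i) → (∀ {i} → m ≤ i → f i ≡ 0) →
                      dropZeros (applyUpTo f n) ≡ applyUpTo f m
dropZeros-applyUpTo f {zero}  {zero}  _         _   _   = refl
dropZeros-applyUpTo f {zero}  {suc n} _         pos zer rewrite zer {0} z≤n =
  dropZeros-applyUpTo (f ∘ suc) {zero} {n} z≤n (λ ()) (λ _ → zer z≤n)
dropZeros-applyUpTo f {suc m} {suc n} (s≤s m≤n) pos zer =
  trans (filter-accept (0 <?_) (pos (s≤s z≤n)))
        (cong (f 0 ∷_) (dropZeros-applyUpTo (f ∘ suc) m≤n (pos ∘ s≤s) (zer ∘ s≤s)))

if-does-just : ∀ {A P : Set} (P? : Dec P) {a b : A} → (if does P? then just a else nothing) ≡ just b → P × a ≡ b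
if-does-just (yes p) refl = p , refl
if-does-just (no _)  ()

if-does-yes : ∀ {A P : Set} (P? : Dec P) {a : A} → P → (if does P? then just a else nothing) ≡ just a
if-does-yes (yes _) _ = refl
if-does-yes (no ¬p) p = ⊥-elim (¬p p)

removeFirstColumn : List ℕ → List ℕ
removeFirstColumn l = dropZeros (map pred l)

first-removeFirstColumn : ∀ {l} → Decreasing l → first (removeFirstColumn l) ≡ pred (first l)
first-removeFirstColumn {[]}     _   = refl
first-removeFirstColumn {x ∷ xs} dec with x
... | zero        = trans (first-removeFirstColumn (Linked.tail dec)) (n≤0⇒n≡0 (pred-mono-≤ (first-≤ dec)))
... | suc zero    = trans (first-removeFirstColumn (Linked.tail dec)) (n≤0⇒n≡0 (pred-mono-≤ (first-≤ dec)))
... | suc (suc _) = refl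

removeFirstColumn-partition : ∀ {l} → IsPartition l → IsPartition (removeFirstColumn l)
removeFirstColumn-partition {l} (dec , _) =
  Linked.filter⁺ (0 <?_) (λ p q → ≤-trans q p) (Linked.map⁺ (Linked.map pred-mono-≤ dec)) ,
  All.all-filter (0 <?_) (map pred l)

length-removeFirstColumn : ∀ l → length (removeFirstColumn l) ≤ length l
length-removeFirstColumn l = ≤-trans (length-filter (0 <?_) (map pred l)) (≤-reflexive (length-map pred l))

sum-removeFirstColumn : ∀ {l} → Positive l → sum l ≡ length l + sum (removeFirstColumn l)
sum-removeFirstColumn [] = refl
sum-removeFirstColumn {suc zero ∷ xs}    (_ ∷ pos) = cong suc (sum-removeFirstColumn pos)
sum-removeFirstColumn {suc (suc x) ∷ xs} (_ ∷ pos) = cong suc (begin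
  suc x + sum xs                                   ≡⟨ cong (suc x +_) (sum-removeFirstColumn pos) ⟩
  suc x + (length xs + sum (removeFirstColumn xs)) ≡⟨ x∙yz≈y∙xz (suc x) (length xs) _ ⟩
  length xs + (suc x + sum (removeFirstColumn xs)) ∎)
  where open ≡-Reasoning

-- columnHeight l c = λ'_{c+1}: columns are numbered from 0.
columnHeight : List ℕ → ℕ → ℕ
columnHeight l c = length (filter (suc c ≤?_) l)

conj-applyUpTo : ∀ l → conj l ≡ applyUpTo (columnHeight l) (first l)
conj-applyUpTo l = map-upTo (columnHeight l) (first l)

columnHeight-∷-< : ∀ {c x} xs → c < x → columnHeight (x ∷ xs) c ≡ suc (columnHeight xs c)
columnHeight-∷-< {c} xs c<x = cong length (filter-accept (suc c ≤?_) {xs = xs} c<x)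

columnHeight-∷-≥ : ∀ {c x} xs → ¬ c < x → columnHeight (x ∷ xs) c ≡ columnHeight xs c
columnHeight-∷-≥ {c} xs c≮x = cong length (filter-reject (suc c ≤?_) {xs = xs} c≮x)

columnHeight-zero : ∀ {l} → Positive l → columnHeight l 0 ≡ length l
columnHeight-zero []                   = refl
columnHeight-zero {_ ∷ xs} (0<x ∷ pos) = trans (columnHeight-∷-< xs 0<x) (cong suc (columnHeight-zero pos))

columnHeight-suc : ∀ l c → columnHeight l (suc c) ≡ columnHeight (removeFirstColumn l) c
columnHeight-suc []                 c = refl
columnHeight-suc (zero ∷ xs)        c = columnHeight-suc xs c
columnHeight-suc (suc zero ∷ xs)    c = columnHeight-suc xs c
columnHeight-suc (suc (suc x) ∷ xs) c with c <? suc x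
... | yes p = trans (columnHeight-∷-< xs (s≤s p))
                    (trans (cong suc (columnHeight-suc xs c)) (sym (columnHeight-∷-< (removeFirstColumn xs) p)))
... | no p  = trans (columnHeight-∷-≥ xs (p ∘ s≤s⁻¹))
                    (trans (columnHeight-suc xs c) (sym (columnHeight-∷-≥ (removeFirstColumn xs) p)))

columnHeight-≤-length : ∀ l c → columnHeight l c ≤ length l
columnHeight-≤-length l c = length-filter (suc c ≤?_) l

columnHeight-antitone : ∀ l c → columnHeight l (suc c) ≤ columnHeight l c
columnHeight-antitone []       c = z≤n
columnHeight-antitone (x ∷ xs) c with suc c <? x | c <? x
... | yes p | yes q rewrite columnHeight-∷-< xs p | columnHeight-∷-< xs q = s≤s (columnHeight-antitone xs c)
... | no p  | yes q rewrite columnHeight-∷-≥ xs p | columnHeight-∷-< xs q = m≤n⇒m≤1+n (columnHeight-antitone xs c)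
... | no p  | no q  rewrite columnHeight-∷-≥ xs p | columnHeight-∷-≥ xs q = columnHeight-antitone xs c
... | yes p | no q  = ⊥-elim (q (<-trans (n<1+n c) p))

columnHeight-positive : ∀ l c → c < first l → 0 < columnHeight l c
columnHeight-positive (x ∷ xs) c c<x rewrite columnHeight-∷-< xs c<x = s≤s z≤n

columnHeight-beyond : ∀ {l c} → All (_≤ c) l → columnHeight l c ≡ 0
columnHeight-beyond []                       = refl
columnHeight-beyond {x ∷ xs} {c} (x≤c ∷ rest) =
  trans (columnHeight-∷-≥ xs (≤⇒≯ x≤c)) (columnHeight-beyond rest)

length-conj : ∀ l → length (conj l) ≡ first l
length-conj l = trans (cong length (conj-applyUpTo l)) (length-applyUpTo (columnHeight l) (first l))

first-conj : ∀ {l} → Positive l → first (conj l) ≡ length l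
first-conj []               = refl
first-conj {suc _ ∷ _} pos = columnHeight-zero pos

first-conj-≤ : ∀ l → first (conj l) ≤ length l
first-conj-≤ []            = z≤n
first-conj-≤ (zero ∷ xs)   = z≤n
first-conj-≤ (suc x ∷ xs)  = columnHeight-≤-length (suc x ∷ xs) 0

conj-partition : ∀ l → IsPartition (conj l)
conj-partition l rewrite conj-applyUpTo l =
  Linked.applyUpTo⁺₂ (columnHeight l) (first l) (columnHeight-antitone l) ,
  All.applyUpTo⁺₁ (columnHeight l) (first l) (columnHeight-positive l _)

conj-removeFirstColumn : ∀ {x xs} → IsPartition (x ∷ xs) →
                         conj (x ∷ xs) ≡ length (x ∷ xs) ∷ conj (removeFirstColumn (x ∷ xs))
conj-removeFirstColumn {zero}  (_ , () ∷ _)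
conj-removeFirstColumn {suc x} {xs} (dec , pos) = begin
  conj (suc x ∷ xs)                                                           ≡⟨ conj-applyUpTo (suc x ∷ xs) ⟩
  columnHeight (suc x ∷ xs) 0 ∷ applyUpTo (columnHeight (suc x ∷ xs) ∘ suc) x ≡⟨ cong₂ _∷_ (columnHeight-zero pos) columns ⟩
  suc (length xs) ∷ applyUpTo (columnHeight rest) (first rest)                ≡⟨ cong (suc (length xs) ∷_) (conj-applyUpTo rest) ⟨
  suc (length xs) ∷ conj rest                                                 ∎
  where
  open ≡-Reasoning
  rest : List ℕ
  rest = removeFirstColumn (suc x ∷ xs)
  columns : applyUpTo (columnHeight (suc x ∷ xs) ∘ suc) x ≡ applyUpTo (columnHeight rest) (first rest)
  columns = trans (applyUpTo-cong _ _ x (λ {c} _ → columnHeight-suc (suc x ∷ xs) c))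
                  (cong (applyUpTo (columnHeight rest)) (sym (first-removeFirstColumn dec)))

removeFirstColumn-conj : ∀ {x xs} → IsPartition (x ∷ xs) → removeFirstColumn (conj (x ∷ xs)) ≡ conj xs
removeFirstColumn-conj {x} {xs} (dec , _) = begin
  dropZeros (map pred (conj (x ∷ xs)))                         ≡⟨ cong (dropZeros ∘ map pred) (conj-applyUpTo (x ∷ xs)) ⟩
  dropZeros (map pred (applyUpTo (columnHeight (x ∷ xs)) x))   ≡⟨ cong dropZeros (map-applyUpTo _ pred x) ⟩
  dropZeros (applyUpTo (pred ∘ columnHeight (x ∷ xs)) x)
    ≡⟨ cong dropZeros (applyUpTo-cong _ _ x (cong pred ∘ columnHeight-∷-< xs)) ⟩
  dropZeros (applyUpTo (columnHeight xs) x)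
    ≡⟨ dropZeros-applyUpTo (columnHeight xs) (first-≤ dec) (columnHeight-positive xs _) vanishes ⟩
  applyUpTo (columnHeight xs) (first xs)                       ≡⟨ conj-applyUpTo xs ⟨
  conj xs                                                      ∎
  where
  open ≡-Reasoning
  vanishes : ∀ {i} → first xs ≤ i → columnHeight xs i ≡ 0
  vanishes first≤i = columnHeight-beyond (All.map (λ y≤first → ≤-trans y≤first first≤i) (all-≤-first (Linked.tail dec)))

conj-involutive : ∀ {l} → IsPartition l → conj (conj l) ≡ l
conj-involutive {[]}         _  = refl
conj-involutive {zero ∷ _}   (_ , () ∷ _)
conj-involutive {suc x ∷ xs} pl = begin
  conj (conj (suc x ∷ xs))
    ≡⟨ conj-removeFirstColumn (conj-partition (suc x ∷ xs)) ⟩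
  length (conj (suc x ∷ xs)) ∷ conj (removeFirstColumn (conj (suc x ∷ xs)))
    ≡⟨ cong₂ _∷_ (length-conj (suc x ∷ xs)) (cong conj (removeFirstColumn-conj pl)) ⟩
  suc x ∷ conj (conj xs)
    ≡⟨ cong (suc x ∷_) (conj-involutive (partition-tail pl)) ⟩
  suc x ∷ xs ∎
  where open ≡-Reasoning

sum-conj : ∀ {l} → IsPartition l → sum (conj l) ≡ sum l
sum-conj {l} pl = bounded (first l) pl ≤-refl
  where
  bounded : ∀ n {l} → IsPartition l → first l ≤ n → sum (conj l) ≡ sum l
  bounded _       {[]}         _            _     = refl
  bounded _       {zero ∷ _}   (_ , () ∷ _) _
  bounded zero    {suc _ ∷ _}  _            ()
  bounded (suc n) {x ∷ xs}     pl           x≤1+n = begin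
    sum (conj (x ∷ xs))                                          ≡⟨ cong sum (conj-removeFirstColumn pl) ⟩
    length (x ∷ xs) + sum (conj (removeFirstColumn (x ∷ xs)))    ≡⟨ cong (length (x ∷ xs) +_) ih ⟩
    length (x ∷ xs) + sum (removeFirstColumn (x ∷ xs))           ≡⟨ sum-removeFirstColumn (proj₂ pl) ⟨
    sum (x ∷ xs)                                                 ∎
    where
    open ≡-Reasoning
    ih : sum (conj (removeFirstColumn (x ∷ xs))) ≡ sum (removeFirstColumn (x ∷ xs))
    ih = bounded n (removeFirstColumn-partition pl)
           (≤-trans (≤-reflexive (first-removeFirstColumn (proj₁ pl))) (pred-mono-≤ x≤1+n))

addColumn : ℕ → List ℕ → List ℕ
addColumn c l = conj (c ∷ conj l)

removeFirstColumn-addColumn : ∀ {c l} → IsPartition l → length l ≤ c → removeFirstColumn (addColumn c l) ≡ l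
removeFirstColumn-addColumn {zero}  {[]} _ _ = refl
removeFirstColumn-addColumn {suc c} {l} pl l≤c = begin
  removeFirstColumn (conj (suc c ∷ conj l)) ≡⟨ removeFirstColumn-conj (∷-partition first≤c (s≤s z≤n) (conj-partition l)) ⟩
  conj (conj l)                             ≡⟨ conj-involutive pl ⟩
  l                                         ∎
  where
  open ≡-Reasoning
  first≤c : first (conj l) ≤ suc c
  first≤c = ≤-trans (first-conj-≤ l) l≤c

addColumn-removeFirstColumn : ∀ {l} → IsPartition l → addColumn (length l) (removeFirstColumn l) ≡ l
addColumn-removeFirstColumn {[]}     _  = refl
addColumn-removeFirstColumn {x ∷ xs} pl = begin
  conj (length (x ∷ xs) ∷ conj (removeFirstColumn (x ∷ xs))) ≡⟨ cong conj (conj-removeFirstColumn pl) ⟨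
  conj (conj (x ∷ xs))                                       ≡⟨ conj-involutive pl ⟩
  x ∷ xs                                                     ∎
  where open ≡-Reasoning

first-addColumn-≤ : ∀ c l → first (addColumn c l) ≤ suc (first l)
first-addColumn-≤ c l = ≤-trans (first-conj-≤ (c ∷ conj l)) (s≤s (≤-reflexive (length-conj l)))

columnToRow : ℕ → List ℕ → List ℕ
columnToRow d ν = d + length ν ∷ removeFirstColumn ν

Insertable : ℕ → List ℕ → Set
Insertable d ν = first ν ≤ length ν + suc d

LongFirstRow : ℕ → List ℕ → Set
LongFirstRow d μ = d + pred (length μ) ≤ first μ

columnToRow-partition : ∀ {d ν} → 0 < d → IsPartition ν → Insertable d ν → IsPartition (columnToRow d ν)
columnToRow-partition {d} {ν} 0<d pν insertable =
  ∷-partition first≤ (≤-trans 0<d (m≤m+n d (length ν))) (removeFirstColumn-partition pν)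
  where
  first≤ : first (removeFirstColumn ν) ≤ d + length ν
  first≤ = begin
    first (removeFirstColumn ν) ≡⟨ first-removeFirstColumn (proj₁ pν) ⟩
    pred (first ν)              ≤⟨ pred-mono-≤ insertable ⟩
    pred (length ν + suc d)     ≡⟨ cong pred (+-suc (length ν) d) ⟩
    length ν + d                ≡⟨ +-comm (length ν) d ⟩
    d + length ν                ∎
    where open ≤-Reasoning

columnToRow-injective : ∀ {d ν ν′} → IsPartition ν → IsPartition ν′ → columnToRow d ν ≡ columnToRow d ν′ → ν ≡ ν′
columnToRow-injective {d} {ν} {ν′} pν pν′ eq = begin
  ν                                            ≡⟨ addColumn-removeFirstColumn pν ⟨
  addColumn (length ν) (removeFirstColumn ν)   ≡⟨ cong₂ addColumn (+-cancelˡ-≡ d _ _ heads) tails ⟩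
  addColumn (length ν′) (removeFirstColumn ν′) ≡⟨ addColumn-removeFirstColumn pν′ ⟩
  ν′                                           ∎
  where
  open ≡-Reasoning
  heads : d + length ν ≡ d + length ν′
  heads = proj₁ (∷-injective eq)
  tails : removeFirstColumn ν ≡ removeFirstColumn ν′
  tails = proj₂ (∷-injective eq)

sum-columnToRow : ∀ d {ν} → Positive ν → sum (columnToRow d ν) ≡ d + sum ν
sum-columnToRow d {ν} pos = begin
  d + length ν + sum (removeFirstColumn ν)   ≡⟨ +-assoc d (length ν) _ ⟩
  d + (length ν + sum (removeFirstColumn ν)) ≡⟨ cong (d +_) (sum-removeFirstColumn pos) ⟨
  d + sum ν                                  ∎
  where open ≡-Reasoning

columnToRow-longFirstRow : ∀ d ν → LongFirstRow d (columnToRow d ν)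
columnToRow-longFirstRow d ν = +-monoʳ-≤ d (length-removeFirstColumn ν)

columnToRow-surjective : ∀ {d μ} → IsPartition μ → 0 < length μ → LongFirstRow d μ →
                         ∃ λ ν → IsPartition ν × Insertable d ν × columnToRow d ν ≡ μ
columnToRow-surjective {d} {a ∷ xs} pμ _ long =
  ν , conj-partition (c ∷ conj xs) , insertable , cong₂ _∷_ firstRow (removeFirstColumn-addColumn (partition-tail pμ) xs≤c)
  where
  c : ℕ
  c = a ∸ d
  ν : List ℕ
  ν = addColumn c xs
  d≤a : d ≤ a
  d≤a = ≤-trans (m≤m+n d (length xs)) long
  xs≤c : length xs ≤ c
  xs≤c = m+n≤o⇒m≤o∸n (length xs) (subst (_≤ a) (+-comm d (length xs)) long)
  firstRow : d + length ν ≡ a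
  firstRow = trans (cong (d +_) (length-conj (c ∷ conj xs))) (m+[n∸m]≡n d≤a)
  insertable : Insertable d ν
  insertable = begin
    first ν              ≤⟨ first-addColumn-≤ c xs ⟩
    suc (first xs)       ≤⟨ s≤s (first-≤ (proj₁ pμ)) ⟩
    suc a                ≡⟨ cong suc (m∸n+n≡m d≤a) ⟨
    suc (c + d)          ≡⟨ +-suc c d ⟨
    c + suc d            ≡⟨ cong (_+ suc d) (length-conj (c ∷ conj xs)) ⟨
    length ν + suc d     ∎
    where open ≤-Reasoning

conjugator : Step → List ℕ → List ℕ
conjugator rho1 = conj
conjugator psi2 = id

boxesAdded : Step → ℕ
boxesAdded rho1 = 1
boxesAdded psi2 = 2

boxesAdded-positive : ∀ s → 0 < boxesAdded s
boxesAdded-positive rho1 = s≤s z≤n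
boxesAdded-positive psi2 = s≤s z≤n

columnToRow-step-partition : ∀ s {ν} → IsPartition ν → Insertable (boxesAdded s) ν →
                             IsPartition (columnToRow (boxesAdded s) ν)
columnToRow-step-partition s = columnToRow-partition (boxesAdded-positive s)

conjugator-partition : ∀ s {l} → IsPartition l → IsPartition (conjugator s l)
conjugator-partition rho1 {l} _  = conj-partition l
conjugator-partition psi2     pl = pl

conjugator-involutive : ∀ s {l} → IsPartition l → conjugator s (conjugator s l) ≡ l
conjugator-involutive rho1 = conj-involutive
conjugator-involutive psi2 _ = refl

conjugator-injective : ∀ s {l l′} → IsPartition l → IsPartition l′ → conjugator s l ≡ conjugator s l′ → l ≡ l′
conjugator-injective s {l} {l′} pl pl′ eq = begin
  l                                ≡⟨ conjugator-involutive s pl ⟨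
  conjugator s (conjugator s l)    ≡⟨ cong (conjugator s) eq ⟩
  conjugator s (conjugator s l′)   ≡⟨ conjugator-involutive s pl′ ⟩
  l′                               ∎
  where open ≡-Reasoning

sum-conjugator : ∀ s {l} → IsPartition l → sum (conjugator s l) ≡ sum l
sum-conjugator rho1 = sum-conj
sum-conjugator psi2 _ = refl

conjugator-nonempty : ∀ s {l} → IsPartition l → 0 < length l → 0 < length (conjugator s l)
conjugator-nonempty rho1 {suc x ∷ xs} _            _ = subst (0 <_) (sym (length-conj (suc x ∷ xs))) (s≤s z≤n)
conjugator-nonempty rho1 {zero ∷ xs}  (_ , () ∷ _) _
conjugator-nonempty psi2              _            0<l = 0<l

applyStep-conjugator : ∀ s {l} → IsPartition l →
  applyStep s l ≡ (if does (first (conjugator s l) ≤? length (conjugator s l) + suc (boxesAdded s))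
                   then just (conjugator s (columnToRow (boxesAdded s) (conjugator s l)))
                   else nothing)
applyStep-conjugator rho1 {l} pl =
  cong₂ (λ j k → if does (k ≤? j + 2) then just (conj (suc j ∷ removeFirstColumn (conj l))) else nothing)
        (sym (length-conj l)) (sym (first-conj (proj₂ pl)))
applyStep-conjugator psi2 _ = refl

applyStep-just : ∀ s {l m} → IsPartition l → applyStep s l ≡ just m →
                 Insertable (boxesAdded s) (conjugator s l) ×
                 conjugator s (columnToRow (boxesAdded s) (conjugator s l)) ≡ m
applyStep-just s {l} pl eq =
  if-does-just (first (conjugator s l) ≤? length (conjugator s l) + suc (boxesAdded s)) (trans (sym (applyStep-conjugator s pl)) eq)

applyStep-insertable : ∀ s {l} → IsPartition l → Insertable (boxesAdded s) (conjugator s l) →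
                       applyStep s l ≡ just (conjugator s (columnToRow (boxesAdded s) (conjugator s l)))
applyStep-insertable s {l} pl insertable =
  trans (applyStep-conjugator s pl)
        (if-does-yes (first (conjugator s l) ≤? length (conjugator s l) + suc (boxesAdded s)) insertable)

applyStep-partition : ∀ s {l m} → IsPartition l → applyStep s l ≡ just m → IsPartition m
applyStep-partition s pl eq with applyStep-just s pl eq
... | insertable , refl =
  conjugator-partition s (columnToRow-step-partition s (conjugator-partition s pl) insertable)

sum-applyStep : ∀ s {l m} → IsPartition l → applyStep s l ≡ just m → sum m ≡ boxesAdded s + sum l
sum-applyStep s {l} pl eq with applyStep-just s pl eq
... | insertable , refl = begin
  sum (conjugator s (columnToRow d ν)) ≡⟨ sum-conjugator s (columnToRow-step-partition s pν insertable) ⟩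
  sum (columnToRow d ν)                ≡⟨ sum-columnToRow d (proj₂ pν) ⟩
  d + sum ν                            ≡⟨ cong (d +_) (sum-conjugator s pl) ⟩
  d + sum l                            ∎
  where
  open ≡-Reasoning
  d : ℕ
  d = boxesAdded s
  ν : List ℕ
  ν = conjugator s l
  pν : IsPartition ν
  pν = conjugator-partition s pl

applyStep-sum-< : ∀ s {l m} → IsPartition l → applyStep s l ≡ just m → sum l < sum m
applyStep-sum-< s {l} pl s↦m = subst (sum l <_) (sym (sum-applyStep s pl s↦m)) (m<n+m (sum l) (boxesAdded-positive s))

applyStep-nonempty : ∀ s {l} → IsPartition l → applyStep s l ≢ just []
applyStep-nonempty s pl s↦[] = n≮0 (applyStep-sum-< s pl s↦[])

-- For nonempty μ, Fits s μ holds exactly when μ is in the image of applyStep s.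
Fits : Step → List ℕ → Set
Fits s μ = LongFirstRow (boxesAdded s) (conjugator s μ)

applyStep-fits : ∀ s {l m} → IsPartition l → applyStep s l ≡ just m → Fits s m
applyStep-fits s {l} pl eq with applyStep-just s pl eq
... | insertable , refl =
  subst (LongFirstRow (boxesAdded s))
        (sym (conjugator-involutive s (columnToRow-step-partition s (conjugator-partition s pl) insertable)))
        (columnToRow-longFirstRow (boxesAdded s) (conjugator s l))

applyStep-injective : ∀ s {l l′ m} → IsPartition l → IsPartition l′ → applyStep s l ≡ just m → applyStep s l′ ≡ just m → l ≡ l′
applyStep-injective s {l} {l′} pl pl′ eq eq′ with applyStep-just s pl eq | applyStep-just s pl′ eq′
... | insertable , image | insertable′ , image′ =
  conjugator-injective s pl pl′
    (columnToRow-injective pν pν′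
      (conjugator-injective s (columnToRow-step-partition s pν insertable)
                              (columnToRow-step-partition s pν′ insertable′)
                              (trans image (sym image′))))
  where
  pν : IsPartition (conjugator s l)
  pν = conjugator-partition s pl
  pν′ : IsPartition (conjugator s l′)
  pν′ = conjugator-partition s pl′

applyStep-surjective : ∀ s {μ} → IsPartition μ → 0 < length μ → Fits s μ →
                       ∃ λ l → IsPartition l × applyStep s l ≡ just μ
applyStep-surjective s {μ} pμ 0<μ fits
  with ν , pν , insertable , ν↦μ ← columnToRow-surjective (conjugator-partition s pμ) (conjugator-nonempty s pμ 0<μ) fits =
  l , pl , (begin
    applyStep s l                                         ≡⟨ applyStep-insertable s pl (subst (Insertable d) (sym l↦ν) insertable) ⟩
    just (conjugator s (columnToRow d (conjugator s l)))  ≡⟨ cong (λ ν′ → just (conjugator s (columnToRow d ν′))) l↦ν ⟩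
    just (conjugator s (columnToRow d ν))                 ≡⟨ cong (just ∘ conjugator s) ν↦μ ⟩
    just (conjugator s (conjugator s μ))                  ≡⟨ cong just (conjugator-involutive s pμ) ⟩
    just μ                                                ∎)
  where
  open ≡-Reasoning
  d : ℕ
  d = boxesAdded s
  l : List ℕ
  l = conjugator s ν
  pl : IsPartition l
  pl = conjugator-partition s pν
  l↦ν : conjugator s l ≡ ν
  l↦ν = conjugator-involutive s pν

fits-rho1 : ∀ {x xs} → IsPartition (x ∷ xs) → Fits rho1 (x ∷ xs) ≡ (x ≤ length (x ∷ xs))
fits-rho1 {zero}      (_ , () ∷ _)
fits-rho1 {suc x} {xs} (_ , pos) =
  cong₂ (λ a b → suc (pred a) ≤ b) (length-conj (suc x ∷ xs)) (first-conj pos)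

fits-unique : ∀ {s t μ} → IsPartition μ → Fits s μ → Fits t μ → s ≡ t
fits-unique {rho1} {rho1} _ _ _ = refl
fits-unique {psi2} {psi2} _ _ _ = refl
fits-unique {rho1} {psi2} {[]}    _  _ ()
fits-unique {psi2} {rho1} {[]}    _  ()
fits-unique {rho1} {psi2} {_ ∷ _} pμ ρ ψ = ⊥-elim (<⇒≱ ψ (subst id (fits-rho1 pμ) ρ))
fits-unique {psi2} {rho1} {_ ∷ _} pμ ψ ρ = ⊥-elim (<⇒≱ ψ (subst id (fits-rho1 pμ) ρ))

fits-some : ∀ {x xs} → IsPartition (x ∷ xs) → ∃ λ s → Fits s (x ∷ xs)
fits-some {x} {xs} pμ with x ≤? length (x ∷ xs)
... | yes x≤len = rho1 , subst id (sym (fits-rho1 pμ)) x≤len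
... | no  x≰len = psi2 , ≰⇒> x≰len

runFromLast : List Step → Maybe (List ℕ)
runFromLast []      = just []
runFromLast (s ∷ r) = runFromLast r >>= applyStep s

run-reverse : ∀ r → run (reverse r) ≡ runFromLast r
run-reverse []      = refl
run-reverse (s ∷ r) = begin
  run (reverse (s ∷ r))               ≡⟨ cong run (unfold-reverse s r) ⟩
  run (reverse r ∷ʳ s)                ≡⟨ foldl-∷ʳ (λ m t → m >>= applyStep t) (just []) s (reverse r) ⟩
  (run (reverse r) >>= applyStep s)   ≡⟨ cong (_>>= applyStep s) (run-reverse r) ⟩
  (runFromLast r >>= applyStep s)     ∎
  where open ≡-Reasoning

runFromLast-∷ : ∀ s r {μ} → runFromLast (s ∷ r) ≡ just μ → ∃ λ l → runFromLast r ≡ just l × applyStep s l ≡ just μ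
runFromLast-∷ s r eq with runFromLast r
... | just l = l , refl , eq

runFromLast-partition : ∀ r {μ} → runFromLast r ≡ just μ → IsPartition μ
runFromLast-partition []      refl = [] , []
runFromLast-partition (s ∷ r) eq
  with l , r↦l , s↦μ ← runFromLast-∷ s r eq = applyStep-partition s (runFromLast-partition r r↦l) s↦μ

runFromLast-injective : ∀ r r′ {μ} → runFromLast r ≡ just μ → runFromLast r′ ≡ just μ → r ≡ r′
runFromLast-injective []      []       _  _ = refl
runFromLast-injective []      (s ∷ r′) refl eq′
  with l , r′↦l , s↦[] ← runFromLast-∷ s r′ eq′ = ⊥-elim (applyStep-nonempty s (runFromLast-partition r′ r′↦l) s↦[])
runFromLast-injective (s ∷ r) []       eq refl
  with l , r↦l , s↦[] ← runFromLast-∷ s r eq = ⊥-elim (applyStep-nonempty s (runFromLast-partition r r↦l) s↦[])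
runFromLast-injective (s ∷ r) (t ∷ r′) eq eq′
  with l , r↦l , s↦μ ← runFromLast-∷ s r eq | l′ , r′↦l′ , t↦μ ← runFromLast-∷ t r′ eq′
  with refl ← fits-unique {s} {t} (runFromLast-partition (s ∷ r) eq)
                          (applyStep-fits s (runFromLast-partition r r↦l) s↦μ)
                          (applyStep-fits t (runFromLast-partition r′ r′↦l′) t↦μ)
  with refl ← applyStep-injective s (runFromLast-partition r r↦l) (runFromLast-partition r′ r′↦l′) s↦μ t↦μ
  = cong (s ∷_) (runFromLast-injective r r′ r↦l r′↦l′)

runFromLast-surjective : ∀ n {μ} → IsPartition μ → sum μ ≤ n → ∃ λ r → runFromLast r ≡ just μ
runFromLast-surjective _       {[]}     _  _ = [] , refl
runFromLast-surjective zero    {zero ∷ _}  (_ , () ∷ _) _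
runFromLast-surjective zero    {suc _ ∷ _} _            ()
runFromLast-surjective (suc n) {x ∷ xs} pμ μ≤1+n
  with s , fits ← fits-some pμ
  with l , pl , s↦μ ← applyStep-surjective s pμ (s≤s z≤n) fits
  with r , r↦l ← runFromLast-surjective n pl (s≤s⁻¹ (≤-trans (applyStep-sum-< s pl s↦μ) μ≤1+n))
  = s ∷ r , trans (cong (_>>= applyStep s) r↦l) s↦μ

proposition3p1 : (l : List ℕ) → IsPartition l →
    ∃! _≡_ (λ (s : List Step) → run s ≡ just l)
proposition3p1 l pl with r , r↦l ← runFromLast-surjective (sum l) pl ≤-refl =
  reverse r , trans (run-reverse r) r↦l , unique
  where
  unique : ∀ {s} → run s ≡ just l → reverse r ≡ s
  unique {s} s↦l = begin
    reverse r             ≡⟨ cong reverse (runFromLast-injective r (reverse s) r↦l reverse-s↦l) ⟩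
    reverse (reverse s)   ≡⟨ reverse-involutive s ⟩
    s                     ∎
    where
    open ≡-Reasoning
    reverse-s↦l : runFromLast (reverse s) ≡ just l
    reverse-s↦l = trans (sym (run-reverse (reverse s))) (trans (cong run (reverse-involutive s)) s↦l)
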